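{- Let $\mathcal{S}_3$ be the set of integer solutions, identified up to permutation of coordinates, of $(x_1+x_2+x_3)^2-(x_1+x_2+x_3)-4(x_1x_2+x_1x_3+x_2x_3)=0$, viewed as a graph with two elements adjacent if (for suitable orderings) they differ in exactly one coordinate. Let $\mathcal{S}_3^+$ and $\mathcal{S}_3^-$ be the sets of elements with $x_1+x_2+x_3+1>0$ and $<0$ respectively. Then $\mathcal{S}_3$ has exactly two connected components, namely $\mathcal{S}_3^+$ and $\mathcal{S}_3^-$. Moreover $\mathcal{S}_3^+=\mathcal{F}_3$, the set of 3-color fair games (solutions with all coordinates non-negative). -}

module Defs where

open import Data.Nat using (ℕ)
open import Data.Fin using (Fin; zero; suc)
open import Data.Fin.Permutation using (Permutation′; _⟨$⟩ʳ_)
open import Data.Integer using (ℤ; _+_; _*_; _-_; _<_; _≤_; +_)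
open import Data.Product using (Σ; ∃; _×_; _,_; proj₁)
open import Relation.Binary.PropositionalEquality using (_≡_; _≢_)
open import Relation.Binary.Construct.Closure.ReflexiveTransitive using (Star)

Triple : Set
Triple = Fin 3 → ℤ

x₁ x₂ x₃ : Triple → ℤ
x₁ x = x zero
x₂ x = x (suc zero)
x₃ x = x (suc (suc zero))

sum3 : Triple → ℤ
sum3 x = x₁ x + x₂ x + x₃ x

e2 : Triple → ℤ
e2 x = x₁ x * x₂ x + x₁ x * x₃ x + x₂ x * x₃ x

IsSolution : Triple → Set
IsSolution x = sum3 x * sum3 x - sum3 x - (+ 4) * e2 x ≡ + 0

-- vertices of 𝒮₃ (as representatives; permuted triples represent the same vertex)
Sol : Set
Sol = Σ Triple IsSolution

DifferInExactlyOne : Triple → Triple → Set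
DifferInExactlyOne x y = ∃ λ i → (x i ≢ y i) × (∀ j → j ≢ i → x j ≡ y j)

Adjacent : Sol → Sol → Set
Adjacent (x , _) (y , _) = ∃ λ (π : Permutation′ 3) → DifferInExactlyOne x (λ i → y (π ⟨$⟩ʳ i))

SameUpToPerm : Triple → Triple → Set
SameUpToPerm x y = ∃ λ (π : Permutation′ 3) → ∀ i → x i ≡ y (π ⟨$⟩ʳ i)

-- lying in the same connected component: a path of adjacencies, where one may also
-- replace a vertex by a permuted representative of itself
Step : Sol → Sol → Set
Step a b = Adjacent a b Data.Sum.⊎ SameUpToPerm (proj₁ a) (proj₁ b)
  where import Data.Sum

Connected : Sol → Sol → Set
Connected = Star Step

InPlus : Sol → Set
InPlus (x , _) = + 0 < sum3 x + + 1

InMinus : Sol → Set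
InMinus (x , _) = sum3 x + + 1 < + 0

InF : Sol → Set
InF (x , _) = ∀ i → + 0 ≤ x i

module Submission where

-- Write s = x₁ + x₂ + x₃.  The equation says s² − s = 4 e₂, so s ≠ −1 by parity.  If some coordinate, say c,
-- is negative, then Φ = (a − b)² + 3c² − (2c + 1)s vanishing forces s < 0; so a vertex with s + 1 > 0 has no
-- negative coordinate.  The reflection x ↦ −1 − x preserves solutions and exchanges the two sides, so a vertex
-- with s + 1 < 0 has only negative coordinates.  Adjacent vertices share a coordinate, hence lie on the same side.
-- Conversely, on the non-negative side the Vieta jump at a coordinate exceeding the sum of the other two is a
-- neighbour with smaller s; when there is no such coordinate, s = Σ xᵢ (xᵢ − other two) ≤ 0 forces x = 0.  So
-- every vertex of 𝒮₃⁺ is connected to (0, 0, 0), and by reflection every vertex of 𝒮₃⁻ to (−1, −1, −1).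

open import Defs
open import Data.Product using (∃; ∃₂; _×_; _,_; proj₁; proj₂)
open import Data.Sum using (_⊎_; inj₁; inj₂)
open import Function.Bundles using (_⇔_; mk⇔)
open import Function.Base using (_∘_)
open import Data.Nat using (zero; suc; s≤s; z≤n)
import Data.Nat.Properties as ℕ
import Data.Nat.Divisibility as ℕ
open import Data.Integer using (ℤ; +_; -[1+_]; _+_; _*_; _-_; -_; _<_; _≤_; _<?_; ∣_∣; nonNegative; +≤+; +<+; -<+)
import Data.Integer.Properties as ℤ
open import Data.Integer.Divisibility.Signed using (divides; ∣⇒∣ᵤ)
open import Data.Integer.Solver using (module +-*-Solver)
open +-*-Solver using (Polynomial; solve; _:=_; _:+_; _:-_; _:*_; :-_; con)
open import Data.Fin using (Fin; zero; suc)
open import Data.Fin.Permutation as Perm using (Permutation′; permutation; _⟨$⟩ʳ_; _⟨$⟩ˡ_; inverseˡ; inverseʳ)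
open import Relation.Binary.PropositionalEquality
open import Relation.Binary.Construct.Closure.ReflexiveTransitive using (ε; _◅_; _◅◅_; gmap; reverse)
open import Relation.Binary.Definitions using (tri<; tri≈; tri>)
open import Relation.Nullary using (Dec; yes; no)
open import Data.Empty using (⊥-elim)

-- IsSolution x unfolds to Φ (x₁ x) (x₂ x) (x₃ x) ≡ + 0; Φ-poly is Φ as a solver polynomial.
Φ : ℤ → ℤ → ℤ → ℤ
Φ a b c = (a + b + c) * (a + b + c) - (a + b + c) - + 4 * (a * b + a * c + b * c)

Φ-poly : ∀ {n} → Polynomial n → Polynomial n → Polynomial n → Polynomial n
Φ-poly a b c = (a :+ b :+ c) :* (a :+ b :+ c) :- (a :+ b :+ c) :- con (+ 4) :* (a :* b :+ a :* c :+ b :* c)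

reflect : ℤ → ℤ
reflect v = - v - + 1

Φ-rotate : ∀ a b c → Φ b c a ≡ Φ a b c
Φ-rotate = solve 3 (λ a b c → Φ-poly b c a := Φ-poly a b c) refl

Φ-reflect : ∀ a b c → Φ (reflect a) (reflect b) (reflect c) ≡ Φ a b c
Φ-reflect = solve 3 (λ a b c → Φ-poly (:- a :- con (+ 1)) (:- b :- con (+ 1)) (:- c :- con (+ 1)) := Φ-poly a b c) refl

-- Φ is monic quadratic in its first argument with root sum 2(b + c) + 1.
Φ-vieta : ∀ a b c → Φ (+ 2 * (b + c) + + 1 - a) b c ≡ Φ a b c
Φ-vieta = solve 3 (λ a b c → Φ-poly (con (+ 2) :* (b :+ c) :+ con (+ 1) :- a) b c := Φ-poly a b c) refl

Φ-negative-third : ∀ a b k →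
  Φ a b (- k) ≡ (a - b) * (a - b) + + 3 * (k * k) + (+ 2 * k - + 1) * (a + b - k)
Φ-negative-third = solve 3 (λ a b k →
  Φ-poly a b (:- k) := (a :- b) :* (a :- b) :+ con (+ 3) :* (k :* k) :+ (con (+ 2) :* k :- con (+ 1)) :* (a :+ b :- k)) refl

Φ-plus-sum : ∀ a b c → Φ a b c + (a + b + c) ≡ a * (a - (b + c)) + b * (b - (c + a)) + c * (c - (a + b))
Φ-plus-sum = solve 3 (λ a b c →
  Φ-poly a b c :+ (a :+ b :+ c) := a :* (a :- (b :+ c)) :+ b :* (b :- (c :+ a)) :+ c :* (c :- (a :+ b))) refl

0≤i∧0≤j⇒0≤i*j : ∀ {i j} → + 0 ≤ i → + 0 ≤ j → + 0 ≤ i * j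
0≤i∧0≤j⇒0≤i*j (+≤+ {n = m} _) (+≤+ {n = n} _) = subst (+ 0 ≤_) (ℤ.pos-* m n) (+≤+ z≤n)

0≤i*i : ∀ i → + 0 ≤ i * i
0≤i*i (+ n) = 0≤i∧0≤j⇒0≤i*j {+ n} {+ n} (+≤+ z≤n) (+≤+ z≤n)
0≤i*i -[1+ n ] = +≤+ z≤n

0≤i⇒i*[i-j]≤0 : ∀ {i j} → + 0 ≤ i → i ≤ j → i * (i - j) ≤ + 0
0≤i⇒i*[i-j]≤0 {i} {j} 0≤i i≤j = subst (i * (i - j) ≤_) (ℤ.*-zeroʳ i)
  (ℤ.*-monoˡ-≤-nonNeg i {{nonNegative 0≤i}} (ℤ.i≤j⇒i-j≤0 i≤j))

2*i≢2*j+1 : ∀ i j → + 2 * i ≢ + 2 * j + + 1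
2*i≢2*j+1 i j eq = ℕ.>⇒∤ (s≤s (s≤s z≤n)) (∣⇒∣ᵤ (divides (i - j) 1≡[i-j]*2))
  where
  open ≡-Reasoning
  1≡[i-j]*2 : + 1 ≡ (i - j) * + 2
  1≡[i-j]*2 = begin
    + 1                      ≡⟨ solve 1 (λ j → con (+ 1) := con (+ 2) :* j :+ con (+ 1) :- con (+ 2) :* j) refl j ⟩
    + 2 * j + + 1 - + 2 * j  ≡⟨ cong (_- + 2 * j) eq ⟨
    + 2 * i - + 2 * j        ≡⟨ solve 2 (λ i j → con (+ 2) :* i :- con (+ 2) :* j := (i :- j) :* con (+ 2)) refl i j ⟩
    (i - j) * + 2            ∎

-- s = −1 would give 4 e₂ = 2.
sum3+1≢0 : ∀ x → IsSolution x → sum3 x + + 1 ≢ + 0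
sum3+1≢0 x p s+1≡0 =
  ℕ.>⇒∤ (s≤s (s≤s (s≤s z≤n))) (∣⇒∣ᵤ (divides (e2 x) (trans 2≡4e₂ (ℤ.*-comm (+ 4) (e2 x)))))
  where
  2≡4e₂ : + 2 ≡ + 4 * e2 x
  2≡4e₂ = ℤ.i-j≡0⇒i≡j (+ 2) (+ 4 * e2 x)
    (subst (λ s → s * s - s - + 4 * e2 x ≡ + 0) (ℤ.i-j≡0⇒i≡j (sum3 x) -[1+ 0 ] s+1≡0) p)

-- With c = −k, every term of Φ-negative-third is ≥ 0 once a + b + c ≥ 0, and 3k² > 0.
solution-negative-third⇒negative-sum : ∀ a b c → Φ a b c ≡ + 0 → c < + 0 → a + b + c < + 0
solution-negative-third⇒negative-sum a b (+ n) _ (+<+ ())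
solution-negative-third⇒negative-sum a b -[1+ m ] Φ≡0 _ = ℤ.≰⇒> λ 0≤s → ℤ.<-irrefl (sym Φ≡0) (0<Φ 0≤s)
  where
  0<Φ : + 0 ≤ a + b + -[1+ m ] → + 0 < Φ a b -[1+ m ]
  0<Φ 0≤s = subst (+ 0 <_) (sym (Φ-negative-third a b (+ suc m)))
    (ℤ.+-mono-<-≤ (ℤ.+-mono-≤-< (0≤i*i (a - b)) (ℤ.positive⁻¹ _))
                  (0≤i∧0≤j⇒0≤i*j {+ 2 * + suc m - + 1} (+≤+ z≤n) 0≤s))

rotation : Permutation′ 3
rotation = permutation next previous
  (λ { zero → refl ; (suc zero) → refl ; (suc (suc zero)) → refl })
  (λ { zero → refl ; (suc zero) → refl ; (suc (suc zero)) → refl })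
  where
  next previous : Fin 3 → Fin 3
  next zero = suc zero
  next (suc zero) = suc (suc zero)
  next (suc (suc zero)) = zero
  previous zero = suc (suc zero)
  previous (suc zero) = zero
  previous (suc (suc zero)) = suc zero

rotate : Triple → Triple
rotate x = x ∘ (rotation ⟨$⟩ʳ_)

rotate-solution : ∀ x → IsSolution x → IsSolution (rotate x)
rotate-solution x p = trans (Φ-rotate (x₁ x) (x₂ x) (x₃ x)) p

sum3-rotate : ∀ x → sum3 (rotate x) ≡ sum3 x
sum3-rotate x = solve 3 (λ a b c → b :+ c :+ a := a :+ b :+ c) refl (x₁ x) (x₂ x) (x₃ x)

negative-coordinate⇒negative-sum : ∀ x → IsSolution x → ∀ i → x i < + 0 → sum3 x < + 0
negative-coordinate⇒negative-sum x p (suc (suc zero)) =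
  solution-negative-third⇒negative-sum (x₁ x) (x₂ x) (x₃ x) p
negative-coordinate⇒negative-sum x p zero xᵢ<0 = subst (_< + 0) (sum3-rotate x)
  (negative-coordinate⇒negative-sum (rotate x) (rotate-solution x p) (suc (suc zero)) xᵢ<0)
negative-coordinate⇒negative-sum x p (suc zero) xᵢ<0 =
  subst (_< + 0) (trans (sum3-rotate (rotate x)) (sum3-rotate x))
    (negative-coordinate⇒negative-sum (rotate (rotate x)) (rotate-solution (rotate x) (rotate-solution x p))
      (suc (suc zero)) xᵢ<0)

negative-coordinate⇒InMinus : ∀ x (p : IsSolution x) → ∀ i → x i < + 0 → InMinus (x , p)
negative-coordinate⇒InMinus x p i xᵢ<0 = ℤ.≤∧≢⇒< s+1≤0 (sum3+1≢0 x p)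
  where
  s+1≤0 : sum3 x + + 1 ≤ + 0
  s+1≤0 = subst (_≤ + 0) (ℤ.+-comm (+ 1) (sum3 x))
    (ℤ.i<j⇒suc[i]≤j (negative-coordinate⇒negative-sum x p i xᵢ<0))

InPlus⇒InF : ∀ (a : Sol) → InPlus a → InF a
InPlus⇒InF (x , p) 0<s+1 i = ℤ.≮⇒≥ λ xᵢ<0 → ℤ.<-asym 0<s+1 (negative-coordinate⇒InMinus x p i xᵢ<0)

InPlus⊎InMinus : ∀ (a : Sol) → InPlus a ⊎ InMinus a
InPlus⊎InMinus (x , p) with ℤ.<-cmp (sum3 x + + 1) (+ 0)
... | tri< s+1<0 _ _ = inj₂ s+1<0
... | tri≈ _ s+1≡0 _ = ⊥-elim (sum3+1≢0 x p s+1≡0)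
... | tri> _ _ 0<s+1 = inj₁ 0<s+1

reflect-involutive : ∀ v → reflect (reflect v) ≡ v
reflect-involutive = solve 1 (λ v → :- (:- v :- con (+ 1)) :- con (+ 1) := v) refl

reflect-injective : ∀ {u v} → reflect u ≡ reflect v → u ≡ v
reflect-injective {u} {v} eq = trans (sym (reflect-involutive u)) (trans (cong reflect eq) (reflect-involutive v))

0≤v⇒reflect[v]<0 : ∀ {v} → + 0 ≤ v → reflect v < + 0
0≤v⇒reflect[v]<0 {+ zero} _ = -<+
0≤v⇒reflect[v]<0 {+ suc n} _ = -<+

v<0⇒0≤reflect[v] : ∀ {v} → v < + 0 → + 0 ≤ reflect v
v<0⇒0≤reflect[v] {+ n} (+<+ ())
v<0⇒0≤reflect[v] { -[1+ n ]} _ = +≤+ z≤n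

mirror : Sol → Sol
mirror (x , p) = reflect ∘ x , trans (Φ-reflect (x₁ x) (x₂ x) (x₃ x)) p

sum3-mirror : ∀ x → sum3 (reflect ∘ x) + + 1 ≡ reflect (sum3 x + + 1)
sum3-mirror x = solve 3 (λ a b c →
  (:- a :- con (+ 1)) :+ (:- b :- con (+ 1)) :+ (:- c :- con (+ 1)) :+ con (+ 1)
    := :- (a :+ b :+ c :+ con (+ 1)) :- con (+ 1))
  refl (x₁ x) (x₂ x) (x₃ x)

InMinus⇒mirror-InPlus : ∀ (a : Sol) → InMinus a → InPlus (mirror a)
InMinus⇒mirror-InPlus a@(x , _) s+1<0 = ℤ.≤∧≢⇒<
  (subst (+ 0 ≤_) (sym (sum3-mirror x)) (v<0⇒0≤reflect[v] s+1<0))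
  (≢-sym (sum3+1≢0 (proj₁ (mirror a)) (proj₂ (mirror a))))

InMinus⇒negative : ∀ (a : Sol) → InMinus a → ∀ i → proj₁ a i < + 0
InMinus⇒negative a@(x , _) s+1<0 i = ℤ.≰⇒> λ 0≤xᵢ →
  ℤ.<⇒≱ (0≤v⇒reflect[v]<0 0≤xᵢ) (InPlus⇒InF (mirror a) (InMinus⇒mirror-InPlus a s+1<0) i)

nonneg-coordinate⇒InPlus : ∀ (a : Sol) i → + 0 ≤ proj₁ a i → InPlus a
nonneg-coordinate⇒InPlus a i 0≤xᵢ with InPlus⊎InMinus a
... | inj₁ plus = plus
... | inj₂ minus = ⊥-elim (ℤ.<⇒≱ (InMinus⇒negative a minus i) 0≤xᵢ)

Adjacent-sym : ∀ {a b} → Adjacent a b → Adjacent b a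
Adjacent-sym {x , _} {y , _} (π , i , xᵢ≢ , agree) = Perm.flip π , π ⟨$⟩ʳ i , differs , agrees
  where
  differs : y (π ⟨$⟩ʳ i) ≢ x (π ⟨$⟩ˡ (π ⟨$⟩ʳ i))
  differs eq = xᵢ≢ (sym (trans eq (cong x (inverseˡ π))))
  agrees : ∀ l → l ≢ π ⟨$⟩ʳ i → y l ≡ x (π ⟨$⟩ˡ l)
  agrees l l≢ = trans (cong y (sym (inverseʳ π)))
    (sym (agree (π ⟨$⟩ˡ l) λ eq → l≢ (trans (sym (inverseʳ π)) (cong (π ⟨$⟩ʳ_) eq))))

SameUpToPerm-sym : ∀ {x y} → SameUpToPerm x y → SameUpToPerm y x
SameUpToPerm-sym {x} {y} (π , agree) =
  Perm.flip π , λ l → trans (cong y (sym (inverseʳ π))) (sym (agree (π ⟨$⟩ˡ l)))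

Step-sym : ∀ {a b} → Step a b → Step b a
Step-sym {a} {b} (inj₁ adj) = inj₁ (Adjacent-sym {a} {b} adj)
Step-sym (inj₂ same) = inj₂ (SameUpToPerm-sym same)

Connected-sym : ∀ {a b} → Connected a b → Connected b a
Connected-sym = reverse (λ {a} {b} → Step-sym {a} {b})

Step-shares-value : ∀ {a b} → Step a b → ∃₂ λ j k → proj₁ a j ≡ proj₁ b k
Step-shares-value (inj₁ (π , zero , _ , agree)) = suc zero , π ⟨$⟩ʳ suc zero , agree (suc zero) λ ()
Step-shares-value (inj₁ (π , suc i , _ , agree)) = zero , π ⟨$⟩ʳ zero , agree zero λ ()
Step-shares-value (inj₂ (π , agree)) = zero , π ⟨$⟩ʳ zero , agree zero

Step-preserves-InPlus : ∀ {a b} → Step a b → InPlus a → InPlus b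
Step-preserves-InPlus {a} {b} step plus with Step-shares-value {a} {b} step
... | j , k , xⱼ≡yₖ = nonneg-coordinate⇒InPlus b k (subst (+ 0 ≤_) xⱼ≡yₖ (InPlus⇒InF a plus j))

Connected-preserves-InPlus : ∀ {a b} → Connected a b → InPlus a → InPlus b
Connected-preserves-InPlus ε = λ plus → plus
Connected-preserves-InPlus {a} (_◅_ {j = m} step path) =
  Connected-preserves-InPlus path ∘ Step-preserves-InPlus {a} {m} step

Connected-preserves-InMinus : ∀ {a b} → Connected a b → InMinus a → InMinus b
Connected-preserves-InMinus {a} {b} path minus with InPlus⊎InMinus b
... | inj₁ plus = ⊥-elim (ℤ.<-asym minus (Connected-preserves-InPlus (Connected-sym path) plus))
... | inj₂ minus′ = minus′

origin : Sol
origin = (λ _ → + 0) , refl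

rotateₛ : Sol → Sol
rotateₛ (x , p) = rotate x , rotate-solution x p

rotate-Step : ∀ a → Step a (rotateₛ a)
rotate-Step (x , _) = inj₂ (Perm.flip rotation , λ i → cong x (sym (inverseʳ rotation)))

jump : Triple → Triple
jump x zero = + 2 * (x₂ x + x₃ x) + + 1 - x₁ x
jump x (suc i) = x (suc i)

jumpₛ : Sol → Sol
jumpₛ (x , p) = jump x , trans (Φ-vieta (x₁ x) (x₂ x) (x₃ x)) p

-- The two roots of the quadratic have odd sum, so they differ.
jump-Step : ∀ a → Step a (jumpₛ a)
jump-Step (x , _) = inj₁ (Perm.id , zero , a≢a′ , λ { zero 0≢0 → ⊥-elim (0≢0 refl) ; (suc j) _ → refl })
  where
  open ≡-Reasoning
  a = x₁ x
  u = x₂ x + x₃ x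
  a≢a′ : a ≢ jump x zero
  a≢a′ eq = 2*i≢2*j+1 a u (begin
    + 2 * a                  ≡⟨ solve 1 (λ a → con (+ 2) :* a := a :+ a) refl a ⟩
    a + a                    ≡⟨ cong (λ a′ → a + a′) eq ⟩
    a + (+ 2 * u + + 1 - a)  ≡⟨ solve 2 (λ a u → a :+ (con (+ 2) :* u :+ con (+ 1) :- a)
                                                := con (+ 2) :* u :+ con (+ 1)) refl a u ⟩
    + 2 * u + + 1            ∎)

jump-decreases : ∀ x → x₂ x + x₃ x < x₁ x → sum3 (jump x) < sum3 x
jump-decreases x u<a = ℤ.+-monoˡ-< (x₃ x) (ℤ.+-monoˡ-< (x₂ x) a′<a)
  where
  open ℤ.≤-Reasoning
  a = x₁ x
  u = x₂ x + x₃ x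
  a′<a : + 2 * u + + 1 - a < a
  a′<a = begin-strict
    + 2 * u + + 1 - a       ≡⟨ solve 2 (λ a u → con (+ 2) :* u :+ con (+ 1) :- a := u :+ (con (+ 1) :+ u) :- a) refl a u ⟩
    u + (+ 1 + u) - a       <⟨ ℤ.+-monoˡ-< (- a) (ℤ.+-mono-<-≤ u<a (ℤ.i<j⇒suc[i]≤j u<a)) ⟩
    a + a - a               ≡⟨ solve 1 (λ a → a :+ a :- a := a) refl a ⟩
    a                       ∎

sum3-nonneg : ∀ x → (∀ i → + 0 ≤ x i) → + 0 ≤ sum3 x
sum3-nonneg x nn = ℤ.+-mono-≤ (ℤ.+-mono-≤ (nn zero) (nn (suc zero))) (nn (suc (suc zero)))

coordinate≤sum3 : ∀ x → (∀ i → + 0 ≤ x i) → ∀ i → x i ≤ sum3 x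
coordinate≤sum3 x nn zero = ℤ.≤-trans
  (ℤ.i≤i+j (x₁ x) (x₂ x) {{nonNegative (nn (suc zero))}})
  (ℤ.i≤i+j (x₁ x + x₂ x) (x₃ x) {{nonNegative (nn (suc (suc zero)))}})
coordinate≤sum3 x nn (suc zero) = ℤ.≤-trans
  (ℤ.i≤j+i (x₂ x) (x₁ x) {{nonNegative (nn zero)}})
  (ℤ.i≤i+j (x₁ x + x₂ x) (x₃ x) {{nonNegative (nn (suc (suc zero)))}})
coordinate≤sum3 x nn (suc (suc zero)) =
  ℤ.i≤j+i (x₃ x) (x₁ x + x₂ x) {{nonNegative (ℤ.+-mono-≤ (nn zero) (nn (suc zero)))}}

-- s = Σ xᵢ (xᵢ − (sum of the other two)) on solutions, and each term is ≤ 0 here.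
balanced-solution≡0 : ∀ x → IsSolution x → (∀ i → + 0 ≤ x i) →
  x₁ x ≤ x₂ x + x₃ x → x₂ x ≤ x₃ x + x₁ x → x₃ x ≤ x₁ x + x₂ x → ∀ i → x i ≡ + 0
balanced-solution≡0 x p nn a≤ b≤ c≤ i =
  ℤ.≤-antisym (ℤ.≤-trans (coordinate≤sum3 x nn i) s≤0) (nn i)
  where
  open ℤ.≤-Reasoning
  a = x₁ x
  b = x₂ x
  c = x₃ x
  s≤0 : sum3 x ≤ + 0
  s≤0 = begin
    sum3 x                                                ≡⟨ ℤ.+-identityˡ (sum3 x) ⟨
    + 0 + sum3 x                                          ≡⟨ cong (_+ sum3 x) p ⟨
    Φ a b c + (a + b + c)                                 ≡⟨ Φ-plus-sum a b c ⟩
    a * (a - (b + c)) + b * (b - (c + a)) + c * (c - (a + b))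
      ≤⟨ ℤ.+-mono-≤ (ℤ.+-mono-≤ (0≤i⇒i*[i-j]≤0 (nn zero) a≤) (0≤i⇒i*[i-j]≤0 (nn (suc zero)) b≤))
                    (0≤i⇒i*[i-j]≤0 (nn (suc (suc zero))) c≤) ⟩
    + 0                                                   ∎

InPlus-connected-to-origin′ : ∀ n (a : Sol) → InPlus a → sum3 (proj₁ a) < + n → Connected a origin
InPlus-connected-to-origin′ zero a plus s<0 = ⊥-elim (ℤ.<⇒≱ s<0 (sum3-nonneg (proj₁ a) (InPlus⇒InF a plus)))
InPlus-connected-to-origin′ (suc n) a@(x , p) plus s<n+1 =
  by-cases (x₂ x + x₃ x <? x₁ x) (x₃ x + x₁ x <? x₂ x) (x₁ x + x₂ x <? x₃ x)
  where
  descend-from : ∀ b → Connected a b → sum3 (proj₁ b) ≡ sum3 x →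
    x₂ (proj₁ b) + x₃ (proj₁ b) < x₁ (proj₁ b) → Connected a origin
  descend-from b a→b same-sum u<a = a→b ◅◅ jump-Step b ◅ InPlus-connected-to-origin′ n (jumpₛ b)
    (Connected-preserves-InPlus {a} {jumpₛ b} (a→b ◅◅ jump-Step b ◅ ε) plus)
    (ℤ.<-≤-trans (jump-decreases (proj₁ b) u<a)
                 (ℤ.i<j⇒i≤pred[j] (subst (_< + suc n) (sym same-sum) s<n+1)))

  by-cases : Dec (x₂ x + x₃ x < x₁ x) → Dec (x₃ x + x₁ x < x₂ x) → Dec (x₁ x + x₂ x < x₃ x) →
    Connected a origin
  by-cases (yes r) _ _ = descend-from a ε refl r
  by-cases (no _) (yes r) _ = descend-from (rotateₛ a) (rotate-Step a ◅ ε) (sum3-rotate x) r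
  by-cases (no _) (no _) (yes r) = descend-from (rotateₛ (rotateₛ a))
    (_◅_ {j = rotateₛ a} (rotate-Step a) (rotate-Step (rotateₛ a) ◅ ε))
    (trans (sum3-rotate (rotate x)) (sum3-rotate x)) r
  by-cases (no r₁) (no r₂) (no r₃) =
    inj₂ (Perm.id , balanced-solution≡0 x p (InPlus⇒InF a plus) (ℤ.≮⇒≥ r₁) (ℤ.≮⇒≥ r₂) (ℤ.≮⇒≥ r₃)) ◅ ε

InPlus-connected-to-origin : ∀ (a : Sol) → InPlus a → Connected a origin
InPlus-connected-to-origin a@(x , _) plus = InPlus-connected-to-origin′ (suc ∣ sum3 x ∣) a plus
  (subst (_< + suc ∣ sum3 x ∣) (ℤ.0≤i⇒+∣i∣≡i (sum3-nonneg x (InPlus⇒InF a plus))) (+<+ (ℕ.n<1+n _)))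

mirror-Step : ∀ {a b} → Step a b → Step (mirror a) (mirror b)
mirror-Step (inj₁ (π , i , xᵢ≢ , agree)) =
  inj₁ (π , i , xᵢ≢ ∘ reflect-injective , λ j j≢i → cong reflect (agree j j≢i))
mirror-Step (inj₂ (π , agree)) = inj₂ (π , cong reflect ∘ agree)

InMinus-connected-to-mirror-origin : ∀ (a : Sol) → InMinus a → Connected a (mirror origin)
InMinus-connected-to-mirror-origin a@(x , _) minus =
  _◅_ {j = mirror (mirror a)} (inj₂ (Perm.id , sym ∘ reflect-involutive ∘ x))
    (gmap mirror (λ {b} {c} → mirror-Step {b} {c})
      (InPlus-connected-to-origin (mirror a) (InMinus⇒mirror-InPlus a minus)))

SameSide : Sol → Sol → Set
SameSide a b = (InPlus a × InPlus b) ⊎ (InMinus a × InMinus b)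

Connected⇒SameSide : ∀ a b → Connected a b → SameSide a b
Connected⇒SameSide a b path with InPlus⊎InMinus a
... | inj₁ plus = inj₁ (plus , Connected-preserves-InPlus path plus)
... | inj₂ minus = inj₂ (minus , Connected-preserves-InMinus path minus)

SameSide⇒Connected : ∀ a b → SameSide a b → Connected a b
SameSide⇒Connected a b (inj₁ (plus-a , plus-b)) =
  InPlus-connected-to-origin a plus-a ◅◅ Connected-sym (InPlus-connected-to-origin b plus-b)
SameSide⇒Connected a b (inj₂ (minus-a , minus-b)) =
  InMinus-connected-to-mirror-origin a minus-a ◅◅ Connected-sym (InMinus-connected-to-mirror-origin b minus-b)

theorem4p9 : (∃ λ (a : Sol) → InPlus a) × (∃ λ (a : Sol) → InMinus a) × (∀ (a : Sol) → InPlus a ⊎ InMinus a) × (∀ (a b : Sol) → Connected a b ⇔ ((InPlus a × InPlus b) ⊎ (InMinus a × InMinus b))) × (∀ (a : Sol) → InPlus a ⇔ InF a)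
theorem4p9 =
  (origin , +<+ (s≤s z≤n)) ,
  (mirror origin , -<+) ,
  InPlus⊎InMinus ,
  (λ a b → mk⇔ (Connected⇒SameSide a b) (SameSide⇒Connected a b)) ,
  (λ a → mk⇔ (InPlus⇒InF a) (λ nonneg → nonneg-coordinate⇒InPlus a zero (nonneg zero)))
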